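{- Let $\Sigma$ be a finite nonempty alphabet, let $x_1, \ldots, x_k \in \Sigma^+$ be nonempty words (not necessarily distinct), and let $m = \sum_{i=1}^k |x_i|$. Then: (a) $\mathrm{nsc}(\{x_1, \ldots, x_k\}^*) \le m - k + 1$; (b) $\mathrm{sc}(\{x_1, \ldots, x_k\}^*) \le 2^{m-k+1}$; (c) if no $x_i$ is a prefix of any other $x_j$, then $\mathrm{sc}(\{x_1, \ldots, x_k\}^*) \le m - k + 2$.
   Context: For a regular language $L$ over $\Sigma$, $\mathrm{sc}(L)$ is the number of states of the minimal (complete) DFA over $\Sigma$ accepting $L$, and $\mathrm{nsc}(L)$ is the number of states of a minimal nondeterministic finite automaton accepting $L$. -}

module Defs where

open import Data.Nat using (ℕ; suc; _≤_)
open import Data.Fin using (Fin)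
open import Data.Bool using (Bool; true)
open import Data.List using (List; []; _∷_; _++_)
open import Data.Vec using (Vec; toList)
open import Data.List.Membership.Propositional using (_∈_)
open import Data.Product using (Σ; ∃; _×_)
open import Function.Bundles using (_⇔_)
open import Relation.Binary.PropositionalEquality using (_≡_)

Word : ℕ → Set
Word σ = List (Fin σ)

Language : ℕ → Set₁
Language σ = Word σ → Set

data Star {σ k : ℕ} (xs : Vec (Word σ) k) : Word σ → Set where
  ε-∈ : Star xs []
  cat : ∀ {x w} → x ∈ toList xs → Star xs w → Star xs (x ++ w)

Prefix : {σ : ℕ} → Word σ → Word σ → Set
Prefix {σ} x y = Σ (Word σ) λ u → x ++ u ≡ y

record DFA (σ n : ℕ) : Set where
  field
    δ      : Fin n → Fin σ → Fin n
    start  : Fin n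
    final  : Fin n → Bool

δ* : ∀ {σ n} → DFA σ n → Fin n → Word σ → Fin n
δ* A q []      = q
δ* A q (a ∷ w) = δ* A (DFA.δ A q a) w

DFAAccepts : ∀ {σ n} → DFA σ n → Language σ
DFAAccepts A w = DFA.final A (δ* A (DFA.start A) w) ≡ true

DFARecognizes : ∀ {σ n} → DFA σ n → Language σ → Set
DFARecognizes A L = ∀ w → DFAAccepts A w ⇔ L w

record NFA (σ n : ℕ) : Set where
  field
    δ      : Fin n → Fin σ → Fin n → Bool
    start  : Fin n
    final  : Fin n → Bool

data Run {σ n : ℕ} (A : NFA σ n) : Fin n → Word σ → Fin n → Set where
  run-[] : ∀ {q} → Run A q [] q
  run-∷  : ∀ {q q' q'' a w} → NFA.δ A q a q' ≡ true → Run A q' w q'' → Run A q (a ∷ w) q''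

NFAAccepts : ∀ {σ n} → NFA σ n → Language σ
NFAAccepts A w = ∃ λ q → Run A (NFA.start A) w q × NFA.final A q ≡ true

NFARecognizes : ∀ {σ n} → NFA σ n → Language σ → Set
NFARecognizes A L = ∀ w → NFAAccepts A w ⇔ L w

IsSC : (σ : ℕ) → Language σ → ℕ → Set
IsSC σ L s = (Σ (DFA σ s) λ A → DFARecognizes A L)
           × (∀ n (A : DFA σ n) → DFARecognizes A L → s ≤ n)

IsNSC : (σ : ℕ) → Language σ → ℕ → Set
IsNSC σ L s = (Σ (NFA σ s) λ A → NFARecognizes A L)
            × (∀ n (A : NFA σ n) → NFARecognizes A L → s ≤ n)

-- Write X = {x₁,…,x_k}. For (a), take as states the empty word together with
-- the nonempty proper suffixes of the xᵢ, |xᵢ| − 1 of them per word: from a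
-- suffix a·u one reads a and moves to u, and from the empty word one reads the
-- first letter a of some xᵢ = a·u and moves to u. The empty word is initial and
-- the only final state, so the language of state u is u·X*. Part (b) is the
-- subset construction applied to this automaton. For (c), the states of a
-- complete DFA are a sink, the empty word and the nonempty proper prefixes of
-- the xᵢ (the trie of X): reading a from p leads to the empty word when p·a ∈ X,
-- to p·a when it is again a proper prefix, and to the sink otherwise. Prefix
-- freeness makes the first factor of a word in X* unique, so the language of
-- state p is exactly {w | p·w ∈ X*}.
module Submission where

open import Defs
open import Data.Nat using (ℕ; suc; _≤_; _+_; _∸_; _^_)
open import Data.Fin using (Fin)
open import Data.List using (length)
open import Data.Vec using (Vec; lookup; map; sum)
open import Data.Product using (_×_)
open import Relation.Binary.PropositionalEquality using (_≢_)
open import Relation.Nullary using (¬_)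

open import Data.Bool as Bool using (Bool; true; false)
open import Data.Empty using (⊥; ⊥-elim)
open import Data.Fin as Fin using (zero; suc; finToFun; funToFin)
open import Data.Fin.Properties using (any?; finToFun-funToFin)
open import Data.List as List using (List; []; _∷_; _++_; _∷ʳ_; [_]; concatMap)
open import Data.List.Properties
  using (≡-dec; ∷-injective; ∷-injectiveʳ; ++-assoc; ++-identityʳ; ++-identityʳ-unique; ++-conicalˡ; ++-conicalʳ; length-++; length-map)
open import Data.List.Membership.Propositional using (_∈_; _∉_; find; lose)
open import Data.List.Membership.Propositional.Properties using (∈-lookup; ∈-map⁺; ∈-map⁻; ∈-concatMap⁺; ∈-concatMap⁻)
open import Data.List.Relation.Unary.Any as Any using (here; there; index)
open import Data.List.Relation.Unary.Any.Properties using (lookup-index)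
open import Data.Nat.Properties using (n≮0; +-suc; +-assoc; +-comm; m+n∸n≡m)
open import Data.Product using (∃; ∃₂; _,_)
open import Data.Sum using (_⊎_; inj₁; inj₂)
open import Data.Vec using ([]; _∷_; toList)
import Data.Vec.Membership.Propositional.Properties as Vec∈
import Data.Vec.Relation.Unary.Any as VecAny
import Data.Vec.Relation.Unary.Any.Properties as VecAny
open import Function using (id; _∘_)
open import Function.Bundles using (_⇔_; mk⇔)
open import Function.Properties.Equivalence using () renaming (trans to ⇔-trans)
open import Relation.Binary.Definitions using (DecidableEquality)
open import Relation.Binary.PropositionalEquality using (_≡_; refl; sym; trans; cong; subst; module ≡-Reasoning)
open import Relation.Nullary using (Dec; yes; no; does)
open import Relation.Nullary.Decidable using (dec-true; _×-dec_; _⊎-dec_)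
open import Relation.Unary using (Decidable)

does-true⁻ : ∀ {P : Set} (P? : Dec P) → does P? ≡ true → P
does-true⁻ (yes p) _ = p
does-true⁻ (no _)  ()

module _ {A : Set} where

  ++-equidivisible : ∀ (x y : List A) {r s} → x ++ r ≡ y ++ s →
    (∃ λ t → y ≡ x ++ t × r ≡ t ++ s) ⊎ (∃ λ t → x ≡ y ++ t × s ≡ t ++ r)
  ++-equidivisible []      y       e = inj₁ (y , refl , e)
  ++-equidivisible (a ∷ x) []      e = inj₂ (a ∷ x , refl , sym e)
  ++-equidivisible (a ∷ x) (b ∷ y) e with refl , e′ ← ∷-injective e
    with ++-equidivisible x y e′
  ... | inj₁ (t , y≡ , r≡) = inj₁ (t , cong (a ∷_) y≡ , r≡)
  ... | inj₂ (t , x≡ , s≡) = inj₂ (t , cong (a ∷_) x≡ , s≡)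

  ProperPrefix : List A → List A → Set
  ProperPrefix p x = ∃₂ λ c t → p ++ c ∷ t ≡ x

  PrefixFree : List (List A) → Set
  PrefixFree X = ∀ {x y t} → x ∈ X → y ∈ X → x ++ t ≡ y → t ≡ []

  prefix-of-∷ʳ : ∀ x p {d t a} → x ++ d ∷ t ≡ p ∷ʳ a → ∃ λ u → x ++ u ≡ p
  prefix-of-∷ʳ x p e with ++-equidivisible x p e
  ... | inj₁ (u , p≡ , _)          = u , sym p≡
  ... | inj₂ ([] , x≡ , _)         = [] , trans (++-identityʳ x) (trans x≡ (++-identityʳ p))
  ... | inj₂ (_ ∷ u , _ , [a]≡) with () ← ++-conicalʳ u _ (sym (∷-injectiveʳ [a]≡))

  ++-prefix-trans : ∀ (x u : List A) {p v y} → x ++ u ≡ p → p ++ v ≡ y → x ++ (u ++ v) ≡ y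
  ++-prefix-trans x u {v = v} refl refl = sym (++-assoc x u v)

  ∷ʳ≢[] : ∀ (p : List A) (a : A) → p ∷ʳ a ≢ []
  ∷ʳ≢[] p a e with () ← ++-conicalʳ p [ a ] e

  nonemptySuffixes : List A → List (List A)
  nonemptySuffixes []      = []
  nonemptySuffixes (a ∷ u) = (a ∷ u) ∷ nonemptySuffixes u

  nonemptyProperSuffixes : List A → List (List A)
  nonemptyProperSuffixes []      = []
  nonemptyProperSuffixes (_ ∷ u) = nonemptySuffixes u

  properPrefixes : List A → List (List A)
  properPrefixes []      = []
  properPrefixes (a ∷ u) = [] ∷ List.map (a ∷_) (properPrefixes u)

  nonemptyProperPrefixes : List A → List (List A)
  nonemptyProperPrefixes []      = []
  nonemptyProperPrefixes (a ∷ u) = List.map (a ∷_) (properPrefixes u)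

  length-nonemptySuffixes : ∀ u → length (nonemptySuffixes u) ≡ length u
  length-nonemptySuffixes []      = refl
  length-nonemptySuffixes (_ ∷ u) = cong suc (length-nonemptySuffixes u)

  length-properPrefixes : ∀ u → length (properPrefixes u) ≡ length u
  length-properPrefixes []      = refl
  length-properPrefixes (a ∷ u) =
    cong suc (trans (length-map (a ∷_) (properPrefixes u)) (length-properPrefixes u))

  length-nonemptyProperSuffixes : ∀ a u → length (nonemptyProperSuffixes (a ∷ u)) ≡ length u
  length-nonemptyProperSuffixes _ = length-nonemptySuffixes

  length-nonemptyProperPrefixes : ∀ a u → length (nonemptyProperPrefixes (a ∷ u)) ≡ length u
  length-nonemptyProperPrefixes a u = trans (length-map (a ∷_) (properPrefixes u)) (length-properPrefixes u)

  ∈-nonemptySuffixes-tail : ∀ {a c u} v → (a ∷ c ∷ u) ∈ nonemptySuffixes v → (c ∷ u) ∈ nonemptySuffixes v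
  ∈-nonemptySuffixes-tail (_ ∷ _) (here refl) = there (here refl)
  ∈-nonemptySuffixes-tail (_ ∷ v) (there m)   = there (∈-nonemptySuffixes-tail v m)

  ∈-nonemptyProperSuffixes-tail : ∀ {a c u} x →
    (a ∷ c ∷ u) ∈ nonemptyProperSuffixes x → (c ∷ u) ∈ nonemptyProperSuffixes x
  ∈-nonemptyProperSuffixes-tail (_ ∷ v) = ∈-nonemptySuffixes-tail v

  ∈-properPrefixes⁺ : ∀ {p x} → ProperPrefix p x → p ∈ properPrefixes x
  ∈-properPrefixes⁺ {[]}    (_ , _ , refl) = here refl
  ∈-properPrefixes⁺ {a ∷ p} (c , t , refl) = there (∈-map⁺ (a ∷_) (∈-properPrefixes⁺ (c , t , refl)))

  ∈-properPrefixes⁻ : ∀ {p} x → p ∈ properPrefixes x → ProperPrefix p x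
  ∈-properPrefixes⁻ (c ∷ t) (here refl) = c , t , refl
  ∈-properPrefixes⁻ (a ∷ x) (there m) with _ , m′ , refl ← ∈-map⁻ (a ∷_) m
    with c , t , refl ← ∈-properPrefixes⁻ x m′ = c , t , refl

  ∈-nonemptyProperPrefixes⁺ : ∀ {a p x} → ProperPrefix (a ∷ p) x → (a ∷ p) ∈ nonemptyProperPrefixes x
  ∈-nonemptyProperPrefixes⁺ (c , t , refl) = ∈-map⁺ (_ ∷_) (∈-properPrefixes⁺ (c , t , refl))

  ∈-nonemptyProperPrefixes⁻ : ∀ {p} x → p ∈ nonemptyProperPrefixes x → ProperPrefix p x
  ∈-nonemptyProperPrefixes⁻ (a ∷ x) m with _ , m′ , refl ← ∈-map⁻ (a ∷_) m
    with c , t , refl ← ∈-properPrefixes⁻ x m′ = c , t , refl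

module _ {A : Set} {k : ℕ} (xs : Vec (List A) k) where

  ∈-toList⇒lookup : ∀ {x} → x ∈ toList xs → ∃ λ i → lookup xs i ≡ x
  ∈-toList⇒lookup x∈ = VecAny.index x∈′ , sym (VecAny.lookup-index x∈′)
    where x∈′ = Vec∈.∈-toList⁻ x∈

  toList-nonempty : (∀ i → 1 ≤ length (lookup xs i)) → ∀ {x} → x ∈ toList xs → x ≢ []
  toList-nonempty lengths x∈ refl with i , xᵢ≡[] ← ∈-toList⇒lookup x∈ =
    n≮0 (subst (λ x → 1 ≤ length x) xᵢ≡[] (lengths i))

toList-prefixFree : ∀ {σ k} (xs : Vec (Word σ) k) →
  (∀ i j → i ≢ j → ¬ Prefix (lookup xs i) (lookup xs j)) → PrefixFree (toList xs)
toList-prefixFree xs notPrefix {t = t} x∈ y∈ x++t≡y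
  with i , refl ← ∈-toList⇒lookup xs x∈ | j , refl ← ∈-toList⇒lookup xs y∈
  with i Fin.≟ j
... | yes refl = ++-identityʳ-unique (lookup xs i) (sym x++t≡y)
... | no i≢j   = ⊥-elim (notPrefix i j i≢j (t , x++t≡y))

length-concatMap-toList : ∀ {A B : Set} {k} (f : List A → List B) →
  (∀ a u → length (f (a ∷ u)) ≡ length u) →
  (xs : Vec (List A) k) → (∀ i → 1 ≤ length (lookup xs i)) →
  length (concatMap f (toList xs)) + k ≡ sum (map length xs)
length-concatMap-toList f length-f []             _       = refl
length-concatMap-toList f length-f ([] ∷ xs)      lengths = ⊥-elim (n≮0 (lengths zero))
length-concatMap-toList {k = suc k} f length-f ((a ∷ u) ∷ xs) lengths = begin
  length (f (a ∷ u) ++ rest) + suc k      ≡⟨ cong (_+ suc k) (length-++ (f (a ∷ u))) ⟩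
  length (f (a ∷ u)) + length rest + suc k ≡⟨ cong (λ n → n + length rest + suc k) (length-f a u) ⟩
  length u + length rest + suc k           ≡⟨ +-assoc (length u) (length rest) (suc k) ⟩
  length u + (length rest + suc k)         ≡⟨ cong (length u +_) (+-suc (length rest) k) ⟩
  length u + suc (length rest + k)         ≡⟨ +-suc (length u) (length rest + k) ⟩
  suc (length u + (length rest + k))       ≡⟨ cong (λ n → suc (length u + n)) tail-count ⟩
  suc (length u + sum (map length xs))     ∎
  where
  open ≡-Reasoning
  rest = concatMap f (toList xs)
  tail-count : length rest + k ≡ sum (map length xs)
  tail-count = length-concatMap-toList f length-f xs (λ i → lengths (suc i))

+-∸-count : ∀ {l k m} c → l + k ≡ m → c + l ≡ m ∸ k + c
+-∸-count {l} {k} c refl = trans (+-comm c l) (cong (_+ c) (sym (m+n∸n≡m l k)))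

-- A set of states S ⊆ Fin n is encoded as funToFin of its indicator Fin n → Fin 2.
module Determinisation {σ n : ℕ} (A : NFA σ n) where
  open NFA A renaming (δ to edge; start to initial; final to accepting)

  _∈ˢ_ : Fin n → Fin (2 ^ n) → Set
  q ∈ˢ S = finToFun S q ≡ suc zero

  _∈ˢ?_ : ∀ q S → Dec (q ∈ˢ S)
  q ∈ˢ? S = finToFun S q Fin.≟ suc zero

  indicator : ∀ {P : Set} → Dec P → Fin 2
  indicator (yes _) = suc zero
  indicator (no _)  = zero

  subset : ∀ {P : Fin n → Set} → Decidable P → Fin (2 ^ n)
  subset P? = funToFin (λ q → indicator (P? q))

  ∈-subset⁺ : ∀ {P : Fin n → Set} (P? : Decidable P) {q} → P q → q ∈ˢ subset P?
  ∈-subset⁺ P? {q} p with P? q | finToFun-funToFin (λ q → indicator (P? q)) q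
  ... | yes _  | eq = eq
  ... | no ¬p  | _  = ⊥-elim (¬p p)

  ∈-subset⁻ : ∀ {P : Fin n → Set} (P? : Decidable P) {q} → q ∈ˢ subset P? → P q
  ∈-subset⁻ P? {q} q∈ with P? q | finToFun-funToFin (λ q → indicator (P? q)) q
  ... | yes p | _  = p
  ... | no _  | eq with () ← trans (sym eq) q∈

  step : Fin (2 ^ n) → Fin σ → Fin (2 ^ n)
  step S a = subset λ q′ → any? λ q → (q ∈ˢ? S) ×-dec (edge q a q′ Bool.≟ true)

  meetsAccepting? : ∀ S → Dec (∃ λ q → q ∈ˢ S × accepting q ≡ true)
  meetsAccepting? S = any? λ q → (q ∈ˢ? S) ×-dec (accepting q Bool.≟ true)

  determinise : DFA σ (2 ^ n)
  determinise = record
    { δ     = step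
    ; start = subset (Fin._≟ initial)
    ; final = λ S → does (meetsAccepting? S)
    }

  ∈-δ*⁺ : ∀ {S q q″} w → q ∈ˢ S → Run A q w q″ → q″ ∈ˢ δ* determinise S w
  ∈-δ*⁺ []      q∈ run-[]        = q∈
  ∈-δ*⁺ (a ∷ w) q∈ (run-∷ e run) = ∈-δ*⁺ w (∈-subset⁺ _ (_ , q∈ , e)) run

  ∈-δ*⁻ : ∀ {S q″} w → q″ ∈ˢ δ* determinise S w → ∃ λ q → q ∈ˢ S × Run A q w q″
  ∈-δ*⁻ []      q″∈ = _ , q″∈ , run-[]
  ∈-δ*⁻ (a ∷ w) q″∈ with q′ , q′∈ , run ← ∈-δ*⁻ w q″∈
    with q , q∈ , e ← ∈-subset⁻ _ q′∈ = q , q∈ , run-∷ e run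

  determinise-recognizes : ∀ {L} → NFARecognizes A L → DFARecognizes determinise L
  determinise-recognizes rec w = ⇔-trans (mk⇔ to from) (rec w)
    where
    to : DFAAccepts determinise w → NFAAccepts A w
    to acc with q″ , q″∈ , fin ← does-true⁻ (meetsAccepting? _) acc
      with q , q∈ , run ← ∈-δ*⁻ w q″∈
      with refl ← ∈-subset⁻ (Fin._≟ initial) q∈ = q″ , run , fin
    from : NFAAccepts A w → DFAAccepts determinise w
    from (q″ , run , fin) =
      dec-true (meetsAccepting? _) (q″ , ∈-δ*⁺ w (∈-subset⁺ (Fin._≟ initial) refl) run , fin)

module StarAutomata {σ k : ℕ} (xs : Vec (Word σ) k) (nonempty : ∀ {x} → x ∈ toList xs → x ≢ []) where

  X : List (Word σ)
  X = toList xs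

  _≟ʷ_ : DecidableEquality (Word σ)
  _≟ʷ_ = ≡-dec Fin._≟_

  open import Data.List.Membership.DecPropositional _≟ʷ_ using (_∈?_)

  first-factor : ∀ {z} → Star xs z → z ≢ [] → ∃₂ λ x r → x ∈ X × x ++ r ≡ z × Star xs r
  first-factor ε-∈        z≢[] = ⊥-elim (z≢[] refl)
  first-factor (cat x∈ s) _    = _ , _ , x∈ , refl , s

  module SuffixNFA where

    states : List (Word σ)
    states = [] ∷ concatMap nonemptyProperSuffixes X

    word : Fin (length states) → Word σ
    word = List.lookup states

    word-index : ∀ {u} (m : u ∈ states) → word (index m) ≡ u
    word-index m = sym (lookup-index m)

    ∈-states-tail : ∀ {a u} → (a ∷ u) ∈ states → u ∈ states
    ∈-states-tail {u = []}    _         = here refl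
    ∈-states-tail {u = _ ∷ _} (there m) =
      there (∈-concatMap⁺ nonemptyProperSuffixes {X}
        (Any.map (λ {x} → ∈-nonemptyProperSuffixes-tail x) (∈-concatMap⁻ nonemptyProperSuffixes {X} m)))

    ∈X⇒tail∈states : ∀ {a u} → (a ∷ u) ∈ X → u ∈ states
    ∈X⇒tail∈states {u = []}    _  = here refl
    ∈X⇒tail∈states {u = _ ∷ _} x∈ = there (∈-concatMap⁺ nonemptyProperSuffixes {X} (lose x∈ (here refl)))

    Edge : Word σ → Fin σ → Word σ → Set
    Edge u a u′ = u ≡ a ∷ u′ ⊎ (u ≡ [] × (a ∷ u′) ∈ X)

    edge? : ∀ u a u′ → Dec (Edge u a u′)
    edge? u a u′ = (u ≟ʷ (a ∷ u′)) ⊎-dec ((u ≟ʷ []) ×-dec ((a ∷ u′) ∈? X))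

    suffixNFA : NFA σ (length states)
    suffixNFA = record
      { δ     = λ q a q′ → does (edge? (word q) a (word q′))
      ; start = zero
      ; final = λ q → does (word q ≟ʷ [])
      }

    run⇒∈·Star : ∀ {q w q″} → Run suffixNFA q w q″ → word q″ ≡ [] →
      ∃ λ v → w ≡ word q ++ v × Star xs v
    run⇒∈·Star run-[] q≡[] = [] , cong (_++ []) (sym q≡[]) , ε-∈
    run⇒∈·Star {q} (run-∷ {q' = q′} {a = a} {w = w} e run) q″≡[]
      with v , w≡ , s ← run⇒∈·Star run q″≡[]
      with does-true⁻ (edge? (word q) a (word q′)) e
    ... | inj₁ q≡ = v , trans (cong (a ∷_) w≡) (cong (_++ v) (sym q≡)) , s
    ... | inj₂ (q≡[] , a∷q′∈X) =
      a ∷ w , cong (_++ a ∷ w) (sym q≡[]) , subst (Star xs) (cong (a ∷_) (sym w≡)) (cat a∷q′∈X s)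

    ∈·Star⇒run : ∀ {u v} (m : u ∈ states) → Star xs v →
      ∃ λ q″ → Run suffixNFA (index m) (u ++ v) q″ × NFA.final suffixNFA q″ ≡ true
    ∈·Star⇒run {[]} m ε-∈ = index m , run-[] , dec-true (_ ≟ʷ []) (word-index m)
    ∈·Star⇒run {[]} m (cat {[]} x∈ _) = ⊥-elim (nonempty x∈ refl)
    ∈·Star⇒run {[]} m (cat {a ∷ u} x∈ s)
      with q″ , run , fin ← ∈·Star⇒run (∈X⇒tail∈states x∈) s =
      q″ , run-∷ (dec-true (edge? _ a _) (inj₂ (word-index m , x∈′))) run , fin
      where
      x∈′ = subst (λ u′ → (a ∷ u′) ∈ X) (sym (word-index (∈X⇒tail∈states x∈))) x∈
    ∈·Star⇒run {a ∷ u} m s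
      with q″ , run , fin ← ∈·Star⇒run (∈-states-tail m) s =
      q″ , run-∷ (dec-true (edge? _ a _) (inj₁ q≡)) run , fin
      where
      q≡ = trans (word-index m) (cong (a ∷_) (sym (word-index (∈-states-tail m))))

    suffixNFA-recognizes : NFARecognizes suffixNFA (Star xs)
    suffixNFA-recognizes w = mk⇔ to (∈·Star⇒run (here refl))
      where
      to : NFAAccepts suffixNFA w → Star xs w
      to (_ , run , fin) with v , refl , s ← run⇒∈·Star run (does-true⁻ (_ ≟ʷ []) fin) = s

  module TrieDFA (prefixFree : PrefixFree X) where

    nodes : List (Word σ)
    nodes = [] ∷ concatMap nonemptyProperPrefixes X

    word : Fin (length nodes) → Word σ
    word = List.lookup nodes

    ∈-nodes⁺ : ∀ {p x} → x ∈ X → ProperPrefix p x → p ∈ nodes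
    ∈-nodes⁺ {[]}    _  _  = here refl
    ∈-nodes⁺ {_ ∷ _} x∈ pp = there (∈-concatMap⁺ nonemptyProperPrefixes {X} (lose x∈ (∈-nonemptyProperPrefixes⁺ pp)))

    ∈-nodes⁻ : ∀ {p} → p ∈ nodes → p ≡ [] ⊎ ∃ λ x → x ∈ X × ProperPrefix p x
    ∈-nodes⁻ (here p≡[]) = inj₁ p≡[]
    ∈-nodes⁻ (there m) with x , x∈ , p∈ ← find (∈-concatMap⁻ nonemptyProperPrefixes {X} m) =
      inj₂ (x , x∈ , ∈-nonemptyProperPrefixes⁻ x p∈)

    X-not-prefix-of-node : ∀ {p x u} → p ∈ nodes → x ∈ X → x ++ u ≡ p → ⊥
    X-not-prefix-of-node {x = x} {u} p∈ x∈ x++u≡p with ∈-nodes⁻ p∈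
    ... | inj₁ refl = nonempty x∈ (++-conicalˡ x u x++u≡p)
    ... | inj₂ (y , y∈ , c , t , p++≡y)
      with () ← ++-conicalʳ u (c ∷ t) (prefixFree x∈ y∈ (++-prefix-trans x u x++u≡p p++≡y))

    Star-node⇒[] : ∀ {p} → p ∈ nodes → Star xs p → p ≡ []
    Star-node⇒[] _  ε-∈        = refl
    Star-node⇒[] p∈ (cat x∈ _) = ⊥-elim (X-not-prefix-of-node p∈ x∈ refl)

    Star-cancel-∈X : ∀ {y w} → y ∈ X → Star xs (y ++ w) → Star xs w
    Star-cancel-∈X {y} y∈ s with first-factor s (nonempty y∈ ∘ ++-conicalˡ y _)
    ... | x , r , x∈ , x++r≡ , s′ with ++-equidivisible x y x++r≡
    ... | inj₁ (_ , y≡ , r≡) with refl ← prefixFree x∈ y∈ (sym y≡) = subst (Star xs) r≡ s′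
    ... | inj₂ (_ , x≡ , w≡) with refl ← prefixFree y∈ x∈ (sym x≡) = subst (Star xs) (sym w≡) s′

    -- The first factor of p·a·w is p·a, a proper extension of p·a, or a prefix of p.
    Star-sink : ∀ {p a w} → p ∈ nodes → p ∷ʳ a ∉ X → p ∷ʳ a ∉ nodes → ¬ Star xs (p ∷ʳ a ++ w)
    Star-sink {p} {a} {w} p∈ y∉X y∉nodes s with first-factor s (∷ʳ≢[] p a ∘ ++-conicalˡ (p ∷ʳ a) w)
    ... | x , _ , x∈ , x++r≡ , _ with ++-equidivisible x (p ∷ʳ a) x++r≡
    ... | inj₁ ([] , y≡ , _)    = y∉X (subst (_∈ X) (trans (sym (++-identityʳ x)) (sym y≡)) x∈)
    ... | inj₁ (_ ∷ _ , y≡ , _) with u , x++u≡p ← prefix-of-∷ʳ x p (sym y≡) =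
      X-not-prefix-of-node p∈ x∈ x++u≡p
    ... | inj₂ ([] , x≡ , _)    = y∉X (subst (_∈ X) (trans x≡ (++-identityʳ _)) x∈)
    ... | inj₂ (d ∷ t , x≡ , _) = y∉nodes (∈-nodes⁺ x∈ (d , t , sym x≡))

    -- State zero is the sink; suc q is the node word q.
    State : Set
    State = Fin (suc (length nodes))

    target : Word σ → State
    target y with y ∈? X
    ... | yes _ = suc zero
    ... | no _ with y ∈? nodes
    ... | yes m = suc (index m)
    ... | no _  = zero

    step : State → Fin σ → State
    step zero    _ = zero
    step (suc q) a = target (word q ∷ʳ a)

    accepting : State → Bool
    accepting zero    = false
    accepting (suc q) = does (word q ≟ʷ [])

    trieDFA : DFA σ (suc (length nodes))
    trieDFA = record { δ = step ; start = suc zero ; final = accepting }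

    Residual : State → Language σ
    Residual zero    _ = ⊥
    Residual (suc q) w = Star xs (word q ++ w)

    accepting-residual : ∀ s → accepting s ≡ true ⇔ Residual s []
    accepting-residual zero    = mk⇔ (λ ()) ⊥-elim
    accepting-residual (suc q) = mk⇔
      (λ e → subst (λ p → Star xs (p ++ [])) (sym (does-true⁻ (word q ≟ʷ []) e)) ε-∈)
      (λ s → dec-true (word q ≟ʷ []) (Star-node⇒[] (∈-lookup q) (subst (Star xs) (++-identityʳ (word q)) s)))

    target-residual : ∀ {p} a w → p ∈ nodes → Residual (target (p ∷ʳ a)) w ⇔ Star xs (p ∷ʳ a ++ w)
    target-residual {p} a w p∈ with p ∷ʳ a ∈? X
    ... | yes y∈ = mk⇔ (cat y∈) (Star-cancel-∈X y∈)
    ... | no y∉X with p ∷ʳ a ∈? nodes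
    ... | yes m = mk⇔ (subst (Star xs) word≡) (subst (Star xs) (sym word≡))
      where word≡ = cong (_++ w) (sym (lookup-index m))
    ... | no y∉nodes = mk⇔ ⊥-elim (Star-sink p∈ y∉X y∉nodes)

    step-residual : ∀ s a w → Residual (step s a) w ⇔ Residual s (a ∷ w)
    step-residual zero    a w = mk⇔ id id
    step-residual (suc q) a w = ⇔-trans (target-residual a w (∈-lookup q))
      (mk⇔ (subst (Star xs) assoc) (subst (Star xs) (sym assoc)))
      where assoc = ++-assoc (word q) [ a ] w

    δ*-residual : ∀ s w → accepting (δ* trieDFA s w) ≡ true ⇔ Residual s w
    δ*-residual s []      = accepting-residual s
    δ*-residual s (a ∷ w) = ⇔-trans (δ*-residual (step s a) w) (step-residual s a w)

    trieDFA-recognizes : DFARecognizes trieDFA (Star xs)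
    trieDFA-recognizes = δ*-residual (suc zero)

proposition6 : (σ : ℕ) → 1 ≤ σ → (k : ℕ) → (xs : Vec (Word σ) k)
    → (∀ i → 1 ≤ length (lookup xs i))
    → let m = sum (map length xs) in
      (∀ s → IsNSC σ (Star xs) s → s ≤ m ∸ k + 1)
    × (∀ s → IsSC σ (Star xs) s → s ≤ 2 ^ (m ∸ k + 1))
    × ((∀ i j → i ≢ j → ¬ Prefix (lookup xs i) (lookup xs j))
       → ∀ s → IsSC σ (Star xs) s → s ≤ m ∸ k + 2)
proposition6 σ _ k xs lengths = nsc-bound , sc-bound , prefixFree-sc-bound
  where
  open StarAutomata xs (toList-nonempty xs lengths)
  open SuffixNFA
  open Determinisation suffixNFA using (determinise; determinise-recognizes)

  m : ℕ
  m = sum (map length xs)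

  #states : length states ≡ m ∸ k + 1
  #states = +-∸-count 1
    (length-concatMap-toList nonemptyProperSuffixes length-nonemptyProperSuffixes xs lengths)

  nsc-bound : ∀ s → IsNSC σ (Star xs) s → s ≤ m ∸ k + 1
  nsc-bound s (_ , minimal) = subst (s ≤_) #states (minimal _ suffixNFA suffixNFA-recognizes)

  sc-bound : ∀ s → IsSC σ (Star xs) s → s ≤ 2 ^ (m ∸ k + 1)
  sc-bound s (_ , minimal) = subst (λ n → s ≤ 2 ^ n) #states
    (minimal _ determinise (determinise-recognizes suffixNFA-recognizes))

  prefixFree-sc-bound : (∀ i j → i ≢ j → ¬ Prefix (lookup xs i) (lookup xs j)) →
    ∀ s → IsSC σ (Star xs) s → s ≤ m ∸ k + 2
  prefixFree-sc-bound notPrefix s (_ , minimal) =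
    subst (s ≤_) #trie-states (minimal _ trieDFA trieDFA-recognizes)
    where
    open TrieDFA (toList-prefixFree xs notPrefix)
    #trie-states : suc (length nodes) ≡ m ∸ k + 2
    #trie-states = +-∸-count 2
      (length-concatMap-toList nonemptyProperPrefixes length-nonemptyProperPrefixes xs lengths)
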